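{- Let $n \geq 3$ and $\ell \geq 0$ be integers and let $W_n$ be the wheel on $n+1$ vertices. Then there exist a minimum zero-forcing set $B$ of $W_n$ and a minimum $\ell$-leaky forcing set $B_\ell$ of $W_n$ with $B \subseteq B_\ell$.
   Context: Let $G=(V,E)$ be a finite simple graph. Color change rule: a colored vertex $v$ colors an uncolored vertex $u$ if $u$ is the only uncolored neighbor of $v$. A zero-forcing set is a set $B\subseteq V$ such that, starting with $B$ colored, repeated application of the rule colors all of $V$; minimum means of minimum size. In $\ell$-leaky forcing, after $B$ is colored an adversary places leaks on at most $\ell$ vertices; a leaky vertex never forces. $B$ is an $\ell$-leaky forcing set if for every placement of at most $\ell$ leaks the process still colors all of $V$. The wheel $W_n$ is obtained from an $n$-cycle by adding a central vertex adjacent to every cycle vertex. -}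

module Defs where

open import Data.Nat using (ℕ; zero; suc; _≤_)
open import Data.Fin using (Fin; toℕ) renaming (zero to fz; suc to fs)
open import Data.Fin.Subset using (Subset; _∈_; _∉_; _⊆_; ∣_∣) renaming (⊥ to ∅)
open import Data.Product using (_×_)
open import Data.Sum using (_⊎_)
open import Data.Unit using (⊤)
open import Data.Empty using (⊥)
open import Relation.Binary.PropositionalEquality using (_≡_; _≢_)

Graph : ℕ → Set₁
Graph m = Fin m → Fin m → Set

CycleAdj : (n : ℕ) → Fin n → Fin n → Set
CycleAdj n i j =
  (suc (toℕ i) ≡ toℕ j) ⊎ (suc (toℕ j) ≡ toℕ i)
  ⊎ ((toℕ i ≡ 0) × (suc (toℕ j) ≡ n)) ⊎ ((toℕ j ≡ 0) × (suc (toℕ i) ≡ n))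

Wheel : (n : ℕ) → Graph (suc n)
Wheel n fz     fz     = ⊥
Wheel n fz     (fs j) = ⊤
Wheel n (fs i) fz     = ⊤
Wheel n (fs i) (fs j) = CycleAdj n i j

-- The least set closed under this rule is the
-- final coloured set of the (order-independent) forcing process.
data Forced {m : ℕ} (G : Graph m) (B L : Subset m) : Fin m → Set where
  init  : ∀ {v} → v ∈ B → Forced G B L v
  force : ∀ {u v} → u ∉ L → G u v → Forced G B L u
        → (∀ w → G u w → w ≢ v → Forced G B L w)
        → Forced G B L v

IsZeroForcingSet : {m : ℕ} → Graph m → Subset m → Set
IsZeroForcingSet G B = ∀ v → Forced G B ∅ v

IsMinZeroForcingSet : {m : ℕ} → Graph m → Subset m → Set
IsMinZeroForcingSet G B =
  IsZeroForcingSet G B × (∀ B′ → IsZeroForcingSet G B′ → ∣ B ∣ ≤ ∣ B′ ∣)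

IsLeakyForcingSet : {m : ℕ} → ℕ → Graph m → Subset m → Set
IsLeakyForcingSet ℓ G B = ∀ (L : Subset _) → ∣ L ∣ ≤ ℓ → ∀ v → Forced G B L v

IsMinLeakyForcingSet : {m : ℕ} → ℕ → Graph m → Subset m → Set
IsMinLeakyForcingSet ℓ G B =
  IsLeakyForcingSet ℓ G B × (∀ B′ → IsLeakyForcingSet ℓ G B′ → ∣ B ∣ ≤ ∣ B′ ∣)

-- The zero forcing number of W_n is 3.  If B is a zero forcing set, some vertex u ∈ B
-- performs a first force, so B contains u and all but one of its neighbours.  In every
-- case this yields, inside B, either the centre with two adjacent rim vertices or a rim
-- vertex with its two rim neighbours, and such a triple is itself zero forcing: once the
-- centre and two adjacent rim vertices are coloured, each rim vertex forces its other
-- rim neighbour, all the way around the cycle.  Hence every zero forcing set contains a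
-- minimum one.  An ℓ-leaky forcing set is in particular zero forcing (take no leaks), and
-- a minimum ℓ-leaky forcing set exists because the forcing process on a finite graph is
-- decidable; so a minimum zero forcing set sits inside it.

module Submission where

open import Defs
open import Data.Nat using (ℕ; zero; suc; _≤_; _<_; _+_; _∸_; z≤n; s≤s; _≤?_; _<?_; _≟_)
open import Data.Nat.Properties
  using (≤-refl; ≤-trans; ≤-antisym; ≤-pred; <-trans; <-irrefl; ≤-<-trans; <-≤-trans; ≮⇒≥;
         n≤1+n; n<1+n; m≤n⇒m≤1+n; 1+n≢n; m+1+n≢n; suc-injective;
         +-suc; +-identityʳ; +-monoˡ-≤; +-monoʳ-≤; m≤n+m; m∸n+n≡m; module ≤-Reasoning)
open import Data.Product using (Σ; _×_; _,_; ∃; proj₁; proj₂)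
open import Data.Sum using (_⊎_; inj₁; inj₂)
open import Data.Empty using (⊥-elim)
open import Data.Unit using (tt)
open import Data.Vec using ([]; _∷_)
open import Function using (_∘_)
open import Data.Fin using (Fin; toℕ; fromℕ<) renaming (zero to fz; suc to fs)
open import Data.Fin.Properties using (any?; all?; toℕ<n; toℕ-fromℕ<; toℕ-injective)
  renaming (_≟_ to _≟ᶠ_; suc-injective to fs-injective)
open import Data.Fin.Subset using (Subset; inside; outside; _∈_; _∉_; _⊆_; ∣_∣; ⁅_⁆; _∪_; _-_)
  renaming (⊥ to ∅; ⊤ to full)
open import Data.Fin.Subset.Properties
  using (_∈?_; anySubset?; ∉⊥; ∈⊤; ∣p∣≤n; ∣⊥∣≡0; p⊂q⇒∣p∣<∣q∣; p⊆p∪q; q⊆p∪q; x∈p∪q⁻;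
         x∈⁅x⁆; x∈⁅y⁆⇒x≡y; ∣⁅x⁆∣≡1; x∈p⇒∣p-x∣<∣p∣; x∈p∧x≢y⇒x∈p-y)
open import Relation.Binary.Definitions using (Decidable)
open import Relation.Nullary using (Dec; yes; no; ¬_)
open import Relation.Nullary.Decidable using (¬?; _×-dec_; _⊎-dec_; _→-dec_; decidable-stable; map′)
open import Relation.Binary.PropositionalEquality
  using (_≡_; _≢_; refl; sym; trans; subst; cong; cong₂; module ≡-Reasoning)

∣p∣<∣p∪⁅x⁆∣ : ∀ {m} {p : Subset m} {x} → x ∉ p → ∣ p ∣ < ∣ p ∪ ⁅ x ⁆ ∣
∣p∣<∣p∪⁅x⁆∣ {p = p} {x} x∉p = p⊂q⇒∣p∣<∣q∣ (p⊆p∪q ⁅ x ⁆ , x , q⊆p∪q p ⁅ x ⁆ (x∈⁅x⁆ x) , x∉p)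

module _ {m : ℕ} (G : Graph m) (L : Subset m) where

  CanForce : Subset m → Fin m → Set
  CanForce S v = ∃ λ u → u ∉ L × u ∈ S × G u v × (∀ w → G u w → w ≢ v → w ∈ S)

  Closed : Subset m → Set
  Closed S = ∀ v → CanForce S v → v ∈ S

  Forced⇒∈closed : ∀ {B S v} → B ⊆ S → Closed S → Forced G B L v → v ∈ S
  Forced⇒∈closed B⊆S closed (init v∈B) = B⊆S v∈B
  Forced⇒∈closed B⊆S closed (force {u} {v} u∉L adj forced-u forced-others) =
    closed v (u , u∉L , Forced⇒∈closed B⊆S closed forced-u , adj ,
              λ w adj′ w≢v → Forced⇒∈closed B⊆S closed (forced-others w adj′ w≢v))

  canForce⇒Forced : ∀ {B S v} → (∀ {w} → w ∈ S → Forced G B L w) → CanForce S v → Forced G B L v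
  canForce⇒Forced sound (u , u∉L , u∈S , adj , others) =
    force u∉L adj (sound u∈S) λ w adj′ w≢v → sound (others w adj′ w≢v)

  record Closure (B : Subset m) : Set where
    field
      set    : Subset m
      ⊇init  : B ⊆ set
      closed : Closed set
      sound  : ∀ {v} → v ∈ set → Forced G B L v

  module _ (adj? : Decidable G) where

    canForce? : ∀ S v → Dec (CanForce S v)
    canForce? S v = any? λ u → ¬? (u ∈? L) ×-dec (u ∈? S) ×-dec adj? u v
      ×-dec all? (λ w → adj? u w →-dec ¬? (w ≟ᶠ v) →-dec (w ∈? S))

    closed⊎canForceNew : ∀ S → Closed S ⊎ ∃ λ v → v ∉ S × CanForce S v
    closed⊎canForceNew S with any? (λ v → ¬? (v ∈? S) ×-dec canForce? S v)
    ... | yes new = inj₂ new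
    ... | no stuck = inj₁ λ v cf → decidable-stable (v ∈? S) λ v∉S → stuck (v , v∉S , cf)

    -- Grow S by one forceable vertex at a time; as ∣ S ∣ ≤ m, fuel m suffices.
    closure : ∀ B → Closure B
    closure B = grow m B (λ v∈B → v∈B) init (m≤n+m m ∣ B ∣)
      where
      grow : ∀ k S → B ⊆ S → (∀ {v} → v ∈ S → Forced G B L v) → m ≤ ∣ S ∣ + k → Closure B
      grow k S B⊆S sound bound with closed⊎canForceNew S
      ... | inj₁ closed = record { set = S ; ⊇init = B⊆S ; closed = closed ; sound = sound }
      grow zero S _ _ bound | inj₂ (v , v∉S , _) =
        ⊥-elim (<-irrefl refl (<-≤-trans (≤-<-trans bound′ (∣p∣<∣p∪⁅x⁆∣ v∉S)) (∣p∣≤n (S ∪ ⁅ v ⁆))))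
        where bound′ = subst (m ≤_) (+-identityʳ ∣ S ∣) bound
      grow (suc k) S B⊆S sound bound | inj₂ (v , v∉S , cf) =
        grow k (S ∪ ⁅ v ⁆) (λ w∈B → p⊆p∪q ⁅ v ⁆ (B⊆S w∈B)) sound′
          (≤-trans bound (subst (_≤ ∣ S ∪ ⁅ v ⁆ ∣ + k) (sym (+-suc ∣ S ∣ k))
                                (+-monoˡ-≤ k (∣p∣<∣p∪⁅x⁆∣ v∉S))))
        where
        sound′ : ∀ {w} → w ∈ S ∪ ⁅ v ⁆ → Forced G B L w
        sound′ w∈ with x∈p∪q⁻ S ⁅ v ⁆ w∈
        ... | inj₁ w∈S = sound w∈S
        ... | inj₂ w∈v rewrite x∈⁅y⁆⇒x≡y v w∈v = canForce⇒Forced sound cf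

    forced? : ∀ B v → Dec (Forced G B L v)
    forced? B v = map′ sound (Forced⇒∈closed ⊇init closed) (v ∈? set)
      where open Closure (closure B)

isLeakyForcingSet? : ∀ {m} ℓ (G : Graph m) → Decidable G → ∀ B → Dec (IsLeakyForcingSet ℓ G B)
isLeakyForcingSet? ℓ G adj? B
  with anySubset? (λ L → (∣ L ∣ ≤? ℓ) ×-dec ¬? (all? (forced? G L adj? B)))
... | yes (L , small , stuck) = no λ leaky → stuck (leaky L small)
... | no none = yes λ L small →
  decidable-stable (all? (forced? G L adj? B)) λ stuck → none (L , small , stuck)

leaky⇒zeroForcing : ∀ {m ℓ} {G : Graph m} {B} → IsLeakyForcingSet ℓ G B → IsZeroForcingSet G B
leaky⇒zeroForcing {m} {ℓ} leaky = leaky ∅ (subst (_≤ ℓ) (sym (∣⊥∣≡0 m)) z≤n)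

zeroForcing⇒canForce : ∀ {m} {G : Graph m} → Decidable G → ∀ {u v} → G u v →
                       ∀ {B} → IsZeroForcingSet G B → ∃ (CanForce G ∅ B)
zeroForcing⇒canForce {G = G} adj? {u} {v} uv {B} zfs with closed⊎canForceNew G ∅ adj? B
... | inj₂ (w , _ , cf) = w , cf
... | inj₁ closed = v , u , ∉⊥ , everywhere u , uv , λ w _ _ → everywhere w
  where
  everywhere : ∀ w → w ∈ B
  everywhere w = Forced⇒∈closed G ∅ (λ w∈B → w∈B) closed (zfs w)

module _ {m : ℕ} {P : Subset m → Set} (P? : ∀ B → Dec (P B)) where

  IsMinimum : Subset m → Set
  IsMinimum B = P B × (∀ B′ → P B′ → ∣ B ∣ ≤ ∣ B′ ∣)

  minimum : P full → ∃ IsMinimum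
  minimum P-full = descend m full P-full (∣p∣≤n full)
    where
    descend : ∀ k B → P B → ∣ B ∣ ≤ k → ∃ IsMinimum
    descend zero B PB ∣B∣≤0 = B , PB , λ B′ _ → ≤-trans ∣B∣≤0 z≤n
    descend (suc k) B PB ∣B∣≤1+k with anySubset? (λ B′ → P? B′ ×-dec (suc ∣ B′ ∣ ≤? ∣ B ∣))
    ... | yes (B′ , PB′ , smaller) = descend k B′ PB′ (≤-pred (≤-trans smaller ∣B∣≤1+k))
    ... | no none = B , PB , λ B′ PB′ → ≮⇒≥ λ smaller → none (B′ , PB′ , smaller)

∣p∪q∣≤∣p∣+∣q∣ : ∀ {m} (p q : Subset m) → ∣ p ∪ q ∣ ≤ ∣ p ∣ + ∣ q ∣
∣p∪q∣≤∣p∣+∣q∣ []            []            = z≤n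
∣p∪q∣≤∣p∣+∣q∣ (outside ∷ p) (outside ∷ q) = ∣p∪q∣≤∣p∣+∣q∣ p q
∣p∪q∣≤∣p∣+∣q∣ (outside ∷ p) (inside ∷ q)  =
  subst (suc ∣ p ∪ q ∣ ≤_) (sym (+-suc ∣ p ∣ ∣ q ∣)) (s≤s (∣p∪q∣≤∣p∣+∣q∣ p q))
∣p∪q∣≤∣p∣+∣q∣ (inside ∷ p)  (outside ∷ q) = s≤s (∣p∪q∣≤∣p∣+∣q∣ p q)
∣p∪q∣≤∣p∣+∣q∣ (inside ∷ p)  (inside ∷ q)  =
  s≤s (≤-trans (∣p∪q∣≤∣p∣+∣q∣ p q) (subst (∣ p ∣ + ∣ q ∣ ≤_) (sym (+-suc ∣ p ∣ ∣ q ∣)) (n≤1+n _)))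

triple : ∀ {m} → Fin m → Fin m → Fin m → Subset m
triple x y z = ⁅ x ⁆ ∪ ⁅ y ⁆ ∪ ⁅ z ⁆

module _ {m : ℕ} (x y z : Fin m) where

  x∈triple : x ∈ triple x y z
  x∈triple = p⊆p∪q (⁅ y ⁆ ∪ ⁅ z ⁆) (x∈⁅x⁆ x)

  y∈triple : y ∈ triple x y z
  y∈triple = q⊆p∪q ⁅ x ⁆ _ (p⊆p∪q ⁅ z ⁆ (x∈⁅x⁆ y))

  z∈triple : z ∈ triple x y z
  z∈triple = q⊆p∪q ⁅ x ⁆ _ (q⊆p∪q ⁅ y ⁆ ⁅ z ⁆ (x∈⁅x⁆ z))

  ∣triple∣≤3 : ∣ triple x y z ∣ ≤ 3
  ∣triple∣≤3 = begin
    ∣ ⁅ x ⁆ ∪ ⁅ y ⁆ ∪ ⁅ z ⁆ ∣           ≤⟨ ∣p∪q∣≤∣p∣+∣q∣ ⁅ x ⁆ _ ⟩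
    ∣ ⁅ x ⁆ ∣ + ∣ ⁅ y ⁆ ∪ ⁅ z ⁆ ∣       ≤⟨ +-monoʳ-≤ ∣ ⁅ x ⁆ ∣ (∣p∪q∣≤∣p∣+∣q∣ ⁅ y ⁆ ⁅ z ⁆) ⟩
    ∣ ⁅ x ⁆ ∣ + (∣ ⁅ y ⁆ ∣ + ∣ ⁅ z ⁆ ∣)
      ≡⟨ cong₂ _+_ (∣⁅x⁆∣≡1 x) (cong₂ _+_ (∣⁅x⁆∣≡1 y) (∣⁅x⁆∣≡1 z)) ⟩
    3                                   ∎
    where open ≤-Reasoning

  triple⊆ : ∀ {p} → x ∈ p → y ∈ p → z ∈ p → triple x y z ⊆ p
  triple⊆ x∈p y∈p z∈p w∈ with x∈p∪q⁻ ⁅ x ⁆ _ w∈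
  ... | inj₁ w∈x rewrite x∈⁅y⁆⇒x≡y x w∈x = x∈p
  ... | inj₂ w∈yz with x∈p∪q⁻ ⁅ y ⁆ ⁅ z ⁆ w∈yz
  ... | inj₁ w∈y rewrite x∈⁅y⁆⇒x≡y y w∈y = y∈p
  ... | inj₂ w∈z rewrite x∈⁅y⁆⇒x≡y z w∈z = z∈p

  3≤∣p∣ : ∀ {p} → x ∈ p → y ∈ p → z ∈ p → x ≢ y → x ≢ z → y ≢ z → 3 ≤ ∣ p ∣
  3≤∣p∣ {p} x∈p y∈p z∈p x≢y x≢z y≢z = begin
    3                                 ≤⟨ s≤s (s≤s (s≤s z≤n)) ⟩
    suc (suc (suc ∣ p - x - y - z ∣)) ≤⟨ s≤s (s≤s (x∈p⇒∣p-x∣<∣p∣ z∈p-x-y)) ⟩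
    suc (suc ∣ p - x - y ∣)           ≤⟨ s≤s (x∈p⇒∣p-x∣<∣p∣ y∈p-x) ⟩
    suc ∣ p - x ∣                     ≤⟨ x∈p⇒∣p-x∣<∣p∣ x∈p ⟩
    ∣ p ∣                             ∎
    where
    open ≤-Reasoning
    y∈p-x = x∈p∧x≢y⇒x∈p-y y∈p (x≢y ∘ sym)
    z∈p-x-y = x∈p∧x≢y⇒x∈p-y (x∈p∧x≢y⇒x∈p-y z∈p (x≢z ∘ sym)) (y≢z ∘ sym)

wheelAdj? : ∀ n → Decidable (Wheel n)
wheelAdj? n fz     fz     = no λ ()
wheelAdj? n fz     (fs j) = yes tt
wheelAdj? n (fs i) fz     = yes tt
wheelAdj? n (fs i) (fs j) =
  suc (toℕ i) ≟ toℕ j ⊎-dec suc (toℕ j) ≟ toℕ i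
  ⊎-dec (toℕ i ≟ 0 ×-dec suc (toℕ j) ≟ n) ⊎-dec (toℕ j ≟ 0 ×-dec suc (toℕ i) ≟ n)

module WheelForcing (m : ℕ) where

  n : ℕ
  n = 3 + m

  -- CycleAdj n i j unfolds to RimAdj (toℕ i) (toℕ j).
  RimAdj : ℕ → ℕ → Set
  RimAdj i j = (suc i ≡ j) ⊎ (suc j ≡ i) ⊎ ((i ≡ 0) × (suc j ≡ n)) ⊎ ((j ≡ 0) × (suc i ≡ n))

  nextᵢ : ℕ → ℕ
  nextᵢ i with suc i <? n
  ... | yes _ = suc i
  ... | no _  = 0

  prevᵢ : ℕ → ℕ
  prevᵢ zero    = 2 + m
  prevᵢ (suc i) = i

  nextᵢ-suc : ∀ {i} → suc i < n → nextᵢ i ≡ suc i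
  nextᵢ-suc {i} 1+i<n with suc i <? n
  ... | yes _     = refl
  ... | no 1+i≮n = ⊥-elim (1+i≮n 1+i<n)

  nextᵢ-last : nextᵢ (2 + m) ≡ 0
  nextᵢ-last with 3 + m <? n
  ... | yes n<n = ⊥-elim (<-irrefl refl n<n)
  ... | no _    = refl

  nextᵢ-< : ∀ i → nextᵢ i < n
  nextᵢ-< i with suc i <? n
  ... | yes 1+i<n = 1+i<n
  ... | no _      = s≤s z≤n

  prevᵢ-< : ∀ {i} → i < n → prevᵢ i < n
  prevᵢ-< {zero}  _     = ≤-refl
  prevᵢ-< {suc i} 1+i<n = <-trans (n<1+n i) 1+i<n

  nextᵢ∘prevᵢ : ∀ {i} → i < n → nextᵢ (prevᵢ i) ≡ i
  nextᵢ∘prevᵢ {zero}  _     = nextᵢ-last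
  nextᵢ∘prevᵢ {suc i} 1+i<n = nextᵢ-suc 1+i<n

  prevᵢ∘nextᵢ : ∀ {i} → i < n → prevᵢ (nextᵢ i) ≡ i
  prevᵢ∘nextᵢ {i} i<n with suc i <? n
  ... | yes _     = refl
  ... | no 1+i≮n = ≤-antisym (≤-pred (≮⇒≥ 1+i≮n)) (≤-pred i<n)

  RimAdj-irrefl : ∀ {i} → ¬ RimAdj i i
  RimAdj-irrefl (inj₁ 1+i≡i)                  = 1+n≢n 1+i≡i
  RimAdj-irrefl (inj₂ (inj₁ 1+i≡i))           = 1+n≢n 1+i≡i
  RimAdj-irrefl (inj₂ (inj₂ (inj₁ (refl , ()))))
  RimAdj-irrefl (inj₂ (inj₂ (inj₂ (refl , ()))))

  RimAdj-nextᵢ : ∀ i → i < n → RimAdj i (nextᵢ i)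
  RimAdj-nextᵢ i i<n with suc i <? n
  ... | yes _     = inj₁ refl
  ... | no 1+i≮n = inj₂ (inj₂ (inj₂ (refl , ≤-antisym i<n (≮⇒≥ 1+i≮n))))

  RimAdj-prevᵢ : ∀ i → RimAdj i (prevᵢ i)
  RimAdj-prevᵢ zero    = inj₂ (inj₂ (inj₁ (refl , refl)))
  RimAdj-prevᵢ (suc i) = inj₂ (inj₁ refl)

  RimAdj⇒nextᵢ⊎prevᵢ : ∀ {i j} → j < n → RimAdj i j → j ≡ nextᵢ i ⊎ j ≡ prevᵢ i
  RimAdj⇒nextᵢ⊎prevᵢ j<n (inj₁ refl)                         = inj₁ (sym (nextᵢ-suc j<n))
  RimAdj⇒nextᵢ⊎prevᵢ _   (inj₂ (inj₁ refl))                  = inj₂ refl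
  RimAdj⇒nextᵢ⊎prevᵢ _   (inj₂ (inj₂ (inj₁ (refl , 1+j≡n)))) = inj₂ (suc-injective 1+j≡n)
  RimAdj⇒nextᵢ⊎prevᵢ _   (inj₂ (inj₂ (inj₂ (refl , 1+i≡n)))) rewrite suc-injective 1+i≡n =
    inj₁ (sym nextᵢ-last)

  nextᵢ≢prevᵢ : ∀ i → nextᵢ i ≢ prevᵢ i
  nextᵢ≢prevᵢ zero    ()
  nextᵢ≢prevᵢ (suc i) with suc (suc i) <? n
  ... | yes _    = m+1+n≢n 1
  ... | no 2+i≮n = λ { refl → 2+i≮n (s≤s (s≤s (s≤s z≤n))) }

  next prev : Fin n → Fin n
  next i = fromℕ< (nextᵢ-< (toℕ i))
  prev i = fromℕ< (prevᵢ-< (toℕ<n i))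

  toℕ-next : ∀ i → toℕ (next i) ≡ nextᵢ (toℕ i)
  toℕ-next i = toℕ-fromℕ< (nextᵢ-< (toℕ i))

  toℕ-prev : ∀ i → toℕ (prev i) ≡ prevᵢ (toℕ i)
  toℕ-prev i = toℕ-fromℕ< (prevᵢ-< (toℕ<n i))

  adj-next : ∀ i → CycleAdj n i (next i)
  adj-next i = subst (RimAdj (toℕ i)) (sym (toℕ-next i)) (RimAdj-nextᵢ (toℕ i) (toℕ<n i))

  adj-prev : ∀ i → CycleAdj n i (prev i)
  adj-prev i = subst (RimAdj (toℕ i)) (sym (toℕ-prev i)) (RimAdj-prevᵢ (toℕ i))

  adj-irrefl : ∀ {i j} → CycleAdj n i j → i ≢ j
  adj-irrefl adj refl = RimAdj-irrefl adj

  adj⇒next⊎prev : ∀ {i j} → CycleAdj n i j → j ≡ next i ⊎ j ≡ prev i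
  adj⇒next⊎prev {i} {j} adj with RimAdj⇒nextᵢ⊎prevᵢ (toℕ<n j) adj
  ... | inj₁ j≡nextᵢ = inj₁ (toℕ-injective (trans j≡nextᵢ (sym (toℕ-next i))))
  ... | inj₂ j≡prevᵢ = inj₂ (toℕ-injective (trans j≡prevᵢ (sym (toℕ-prev i))))

  next≢prev : ∀ i → next i ≢ prev i
  next≢prev i eq =
    nextᵢ≢prevᵢ (toℕ i) (trans (sym (toℕ-next i)) (trans (cong toℕ eq) (toℕ-prev i)))

  next∘prev : ∀ i → next (prev i) ≡ i
  next∘prev i = toℕ-injective (begin
    toℕ (next (prev i))   ≡⟨ toℕ-next (prev i) ⟩
    nextᵢ (toℕ (prev i))  ≡⟨ cong nextᵢ (toℕ-prev i) ⟩
    nextᵢ (prevᵢ (toℕ i)) ≡⟨ nextᵢ∘prevᵢ (toℕ<n i) ⟩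
    toℕ i                 ∎)
    where open ≡-Reasoning

  prev∘next : ∀ i → prev (next i) ≡ i
  prev∘next i = toℕ-injective (begin
    toℕ (prev (next i))   ≡⟨ toℕ-prev (next i) ⟩
    prevᵢ (toℕ (next i))  ≡⟨ cong prevᵢ (toℕ-next i) ⟩
    prevᵢ (nextᵢ (toℕ i)) ≡⟨ prevᵢ∘nextᵢ (toℕ<n i) ⟩
    toℕ i                 ∎)
    where open ≡-Reasoning

  module Spread {T : Subset (suc n)} (forced-centre : Forced (Wheel n) T ∅ fz) where

    F : Fin (suc n) → Set
    F = Forced (Wheel n) T ∅

    pass : ∀ {i} → F (fs (prev i)) → F (fs i) → F (fs (next i))
    pass {i} forced-prev forced-i = force ∉⊥ (adj-next i) forced-i others
      where
      others : ∀ w → Wheel n (fs i) w → w ≢ fs (next i) → F w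
      others fz     _   _ = forced-centre
      others (fs j) adj j≢next with adj⇒next⊎prev adj
      ... | inj₁ refl = ⊥-elim (j≢next refl)
      ... | inj₂ refl = forced-prev

    -- Rim k is vacuous for k ≥ n.
    Rim : ℕ → Set
    Rim k = ∀ i → toℕ i ≡ k → F (fs i)

    Rim-intro : ∀ {i} → F (fs i) → Rim (toℕ i)
    Rim-intro forced-i j j≡i = subst (F ∘ fs) (sym (toℕ-injective j≡i)) forced-i

    Rim-pass : ∀ {k} → k < n → Rim (prevᵢ k) → Rim k → Rim (nextᵢ k)
    Rim-pass k<n Rim-prevᵢ Rim-k =
      subst Rim (trans (toℕ-next u) (cong nextᵢ u≡k))
        (Rim-intro (pass (Rim-prevᵢ (prev u) (trans (toℕ-prev u) (cong prevᵢ u≡k))) (Rim-k u u≡k)))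
      where
      u = fromℕ< k<n
      u≡k = toℕ-fromℕ< k<n

    Rim-step : ∀ k → Rim k → Rim (suc k) → Rim (suc (suc k))
    Rim-step k Rim-k Rim-1+k i i≡2+k =
      Rim-pass 1+k<n Rim-k Rim-1+k i (trans i≡2+k (sym (nextᵢ-suc 2+k<n)))
      where
      2+k<n = subst (_< n) i≡2+k (toℕ<n i)
      1+k<n = <-trans (n<1+n _) 2+k<n

    Rim-from : ∀ {a} → Rim a → Rim (suc a) → ∀ {k} → a ≤ k → Rim k
    Rim-from {a} Rim-a Rim-1+a {k} a≤k = subst Rim (m∸n+n≡m a≤k) (proj₁ (pairs (k ∸ a)))
      where
      pairs : ∀ d → Rim (d + a) × Rim (suc d + a)
      pairs zero    = Rim-a , Rim-1+a
      pairs (suc d) = proj₂ (pairs d) , Rim-step (d + a) (proj₁ (pairs d)) (proj₂ (pairs d))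

    around : Rim (2 + m) → Rim 0 → ∀ v → F v
    around Rim-last Rim-0 fz     = forced-centre
    around Rim-last Rim-0 (fs i) = Rim-from Rim-0 Rim-1 z≤n i refl
      where Rim-1 = subst Rim (nextᵢ-suc (s≤s (s≤s z≤n))) (Rim-pass (s≤s z≤n) Rim-last Rim-0)

    spreadᵢ : ∀ {a} → a < n → Rim a → Rim (nextᵢ a) → ∀ v → F v
    spreadᵢ {a} a<n Rim-a Rim-nextᵢ with suc a <? n
    ... | yes (s≤s (s≤s a≤1+m)) =
      around Rim-last (subst Rim nextᵢ-last (Rim-pass ≤-refl Rim-penultimate Rim-last))
      where
      Rim-penultimate = Rim-from Rim-a Rim-nextᵢ a≤1+m
      Rim-last = Rim-from Rim-a Rim-nextᵢ (m≤n⇒m≤1+n a≤1+m)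
    ... | no 1+a≮n rewrite ≤-antisym (≤-pred a<n) (≤-pred (≮⇒≥ 1+a≮n)) = around Rim-a Rim-nextᵢ

    spread : ∀ {i} → F (fs i) → F (fs (next i)) → ∀ v → F v
    spread {i} forced-i forced-next =
      spreadᵢ (toℕ<n i) (Rim-intro forced-i) (subst Rim (toℕ-next i) (Rim-intro forced-next))

  record ForcingTriple (B : Subset (suc n)) : Set where
    field
      x y z       : Fin (suc n)
      x≢y         : x ≢ y
      x≢z         : x ≢ z
      y≢z         : y ≢ z
      x∈B         : x ∈ B
      y∈B         : y ∈ B
      z∈B         : z ∈ B
      zeroForcing : IsZeroForcingSet (Wheel n) (triple x y z)

  centreEdgeTriple : ∀ {B} i → fz ∈ B → fs i ∈ B → fs (next i) ∈ B → ForcingTriple B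
  centreEdgeTriple i c∈B i∈B next∈B = record
    { x∈B = c∈B ; y∈B = i∈B ; z∈B = next∈B
    ; x≢y = λ () ; x≢z = λ ()
    ; y≢z = adj-irrefl (adj-next i) ∘ fs-injective
    ; zeroForcing = Spread.spread (init (x∈triple fz i′ n′)) (init (y∈triple fz i′ n′))
                                    (init (z∈triple fz i′ n′)) }
    where
    i′ = fs i ; n′ = fs (next i)

  pathTriple : ∀ {B} i → fs i ∈ B → fs (prev i) ∈ B → fs (next i) ∈ B → ForcingTriple B
  pathTriple i i∈B prev∈B next∈B = record
    { x∈B = i∈B ; y∈B = prev∈B ; z∈B = next∈B
    ; x≢y = adj-irrefl (adj-prev i) ∘ fs-injective
    ; x≢z = adj-irrefl (adj-next i) ∘ fs-injective
    ; y≢z = next≢prev i ∘ sym ∘ fs-injective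
    ; zeroForcing = Spread.spread forced-centre forced-i forced-next }
    where
    i′ = fs i ; p′ = fs (prev i) ; n′ = fs (next i)
    forced-i    = init (x∈triple i′ p′ n′)
    forced-prev = init (y∈triple i′ p′ n′)
    forced-next = init (z∈triple i′ p′ n′)
    forced-centre : Forced (Wheel n) (triple i′ p′ n′) ∅ fz
    forced-centre = force ∉⊥ tt forced-i others
      where
      others : ∀ w → Wheel n (fs i) w → w ≢ fz → Forced (Wheel n) (triple i′ p′ n′) ∅ w
      others fz     _   fz≢fz = ⊥-elim (fz≢fz refl)
      others (fs j) adj _ with adj⇒next⊎prev adj
      ... | inj₁ refl = forced-next
      ... | inj₂ refl = forced-prev

  next²≢id : ∀ i → next (next i) ≢ i
  next²≢id i eq = next≢prev i (trans (sym (prev∘next (next i))) (cong prev eq))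

  forcingTriple : ∀ {B} → IsZeroForcingSet (Wheel n) B → ForcingTriple B
  forcingTriple {B} zfs = fromFirstForce (zeroForcing⇒canForce (wheelAdj? n) {fz} {fs fz} tt zfs)
    where
    fromFirstForce : ∃ (CanForce (Wheel n) ∅ B) → ForcingTriple B
    fromFirstForce (fz , fz , _ , _ , () , _)
    fromFirstForce (fs j , fz , _ , c∈B , _ , others) =
      centreEdgeTriple (next j) c∈B
        (others _ tt (adj-irrefl (adj-next j) ∘ sym ∘ fs-injective))
        (others _ tt (next²≢id j ∘ fs-injective))
    fromFirstForce (fz , fs i , _ , i∈B , _ , others) =
      pathTriple i i∈B (others _ (adj-prev i) λ ()) (others _ (adj-next i) λ ())
    fromFirstForce (fs j , fs i , _ , i∈B , adj , others) with adj⇒next⊎prev adj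
    ... | inj₁ refl =
      centreEdgeTriple (prev i) (others fz tt λ ())
        (others _ (adj-prev i) (next≢prev i ∘ sym ∘ fs-injective))
        (subst (λ v → fs v ∈ B) (sym (next∘prev i)) i∈B)
    ... | inj₂ refl =
      centreEdgeTriple i (others fz tt λ ()) i∈B
        (others _ (adj-next i) (next≢prev i ∘ fs-injective))

  zeroForcing⇒3≤∣B∣ : ∀ {B} → IsZeroForcingSet (Wheel n) B → 3 ≤ ∣ B ∣
  zeroForcing⇒3≤∣B∣ zfs = 3≤∣p∣ x y z x∈B y∈B z∈B x≢y x≢z y≢z
    where open ForcingTriple (forcingTriple zfs)

  zeroForcing⇒⊇minimum : ∀ {B} → IsZeroForcingSet (Wheel n) B →
                         ∃ λ T → IsMinZeroForcingSet (Wheel n) T × T ⊆ B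
  zeroForcing⇒⊇minimum zfs =
    triple x y z ,
    (zeroForcing , λ B′ zfs′ → ≤-trans (∣triple∣≤3 x y z) (zeroForcing⇒3≤∣B∣ zfs′)) ,
    triple⊆ x y z x∈B y∈B z∈B
    where open ForcingTriple (forcingTriple zfs)

corollary4p5 : (n ℓ : ℕ) → 3 ≤ n →
    Σ (Subset (suc n)) λ B → Σ (Subset (suc n)) λ Bℓ →
      IsMinZeroForcingSet (Wheel n) B × IsMinLeakyForcingSet ℓ (Wheel n) Bℓ × B ⊆ Bℓ
corollary4p5 n@(suc (suc (suc m))) ℓ (s≤s (s≤s (s≤s z≤n))) =
  let Bℓ , minLeaky = minimum (isLeakyForcingSet? ℓ (Wheel n) (wheelAdj? n)) λ _ _ _ → init ∈⊤
      B , minZeroForcing , B⊆Bℓ =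
        WheelForcing.zeroForcing⇒⊇minimum m (leaky⇒zeroForcing (proj₁ minLeaky))
  in  B , Bℓ , minZeroForcing , minLeaky , B⊆Bℓ
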